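{- Let $T$ be a rectangular standard Young tableau with $N=nk$ boxes, $n$ rows and $k$ columns, and let $\mathcal{M}^T=(\mathcal{M}_1,\ldots,\mathcal{M}_{n-1})$ be the multicolored noncrossing matching obtained from $T$ by the row-pairing algorithm described below. Then each arc $(i,j)\in\mathcal{M}_x$ satisfies: (1) if $x>1$, the arc shares its endpoint $i$ with exactly one other arc of $\mathcal{M}^T$, and that arc lies in $\mathcal{M}_{x-1}$; (2) if $x<n-1$, the arc shares its endpoint $j$ with exactly one other arc of $\mathcal{M}^T$, and that arc lies in $\mathcal{M}_{x+1}$; (3) if $x=1$ then $i$ lies on no other arc, and if $x=n-1$ then $j$ lies on no other arc.
   Context: A rectangular standard Young tableau of shape $n\times k$ is a filling of an $n$-row, $k$-column array of boxes bijectively with $1,\ldots,N$ ($N=nk$) so that entries strictly increase left to right along rows and top to bottom along columns; rows are numbered $1,\ldots,n$ from top to bottom. An arc in $\{1,\ldots,N\}$ is an ordered pair $(i,j)$ with $i<j$; $i,j$ are its boundary points. A matching is a set of arcs with pairwise disjoint boundary points; it is noncrossing if no two arcs $(i,j),(i',j')$ satisfy $i<i'<j<j'$. A multicolored (noncrossing) matching is a tuple $(\mathcal{M}_1,\ldots,\mathcal{M}_{n-1})$ of (noncrossing) matchings on $\{1,\ldots,N\}$ (arcs of $\mathcal{M}_x$ have color $x$; arcs of different colors may share endpoints or cross) such that every element of $\{1,\ldots,N\}$ is a boundary point of some arc. The matching $\mathcal{M}^T$ is built as follows: for each $x=1,\ldots,n-1$, read the entries $j$ of row $x+1$ from left to right;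 for each such $j$, let $i$ be the rightmost entry of row $x$ that is smaller than $j$ and not yet paired with an entry of row $x+1$, and put the arc $(i,j)$ into $\mathcal{M}_x$. -}

module Defs where

open import Data.Nat using (ℕ; zero; suc; _+_; _*_; _∸_; _≤_; _<_; _<ᵇ_)
open import Data.Nat.Properties using (_<?_)
open import Data.Fin using (Fin; fromℕ<) renaming (_<_ to _<F_)
open import Data.List using (List; []; _∷_; map; allFin)
open import Data.List.Membership.Propositional using (_∈_)
open import Data.Maybe using (Maybe; just; nothing)
open import Data.Bool using (if_then_else_)
open import Data.Product using (_×_; _,_; ∃-syntax)
open import Data.Sum using (_⊎_)
open import Relation.Nullary using (yes; no)
open import Relation.Binary.PropositionalEquality using (_≡_)

-- A filling of an n × k array: T r c is the entry in row r, column c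
-- (0-indexed Fin's internally; row r corresponds to paper's row r+1).
Filling : ℕ → ℕ → Set
Filling n k = Fin n → Fin k → ℕ

record IsRectSYT (n k : ℕ) (T : Filling n k) : Set where
  field
    range     : ∀ r c → 1 ≤ T r c × T r c ≤ n * k
    injective : ∀ r c r' c' → T r c ≡ T r' c' → (r ≡ r') × (c ≡ c')
    surjective : ∀ m → 1 ≤ m → m ≤ n * k → ∃[ r ] ∃[ c ] (T r c ≡ m)
    rowIncr   : ∀ r c c' → c <F c' → T r c < T r c'
    colIncr   : ∀ c r r' → r <F r' → T r c < T r' c

Arc : Set
Arc = ℕ × ℕ

OnArc : ℕ → Arc → Set
OnArc p (i , j) = (p ≡ i) ⊎ (p ≡ j)

pick : List ℕ → ℕ → Maybe (ℕ × List ℕ)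
pick [] j = nothing
pick (a ∷ as) j with pick as j
... | just (i , rest) = just (i , a ∷ rest)
... | nothing = if a <ᵇ j then just (a , as) else nothing

pairRows : List ℕ → List ℕ → List Arc
pairRows avail [] = []
pairRows avail (j ∷ js) with pick avail j
... | just (i , rest) = (i , j) ∷ pairRows rest js
... | nothing = pairRows avail js

-- Paper's row r (1-indexed), read left to right; empty if r is out of range.
rowList : ∀ {n k} → Filling n k → ℕ → List ℕ
rowList {n} {k} T r with (r ∸ 1) <? n
... | yes p = map (T (fromℕ< p)) (allFin k)
... | no _ = []

M : ∀ {n k} → Filling n k → ℕ → List Arc
M T x = pairRows (rowList T x) (rowList T (suc x))

ArcOf : ∀ {n k} → Filling n k → ℕ → Arc → Set
ArcOf {n} T y b = (1 ≤ y) × (suc y ≤ n) × (b ∈ M T y)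

-- Row pairing between consecutive rows x and x+1 uses every entry of each row exactly once,
-- provided the Hall-type condition holds that the t-th entry of the lower row exceeds at least
-- t entries of the upper row; in a rectangular tableau it does, because the first t entries of
-- row x all lie above or to the left of the t-th entry of row x+1. Since the rows partition the
-- entries, a number in row z lies only on the arc of colour z pairing it downwards and on the
-- arc of colour z−1 pairing it upwards, and these exist exactly when rows z+1, resp. z−1, exist.
module Submission where

open import Data.Bool using (true; false; T)
open import Data.Empty using (⊥-elim)
open import Data.Fin using (Fin; toℕ; fromℕ<) renaming (zero to fzero; suc to fsuc; _<_ to _<F_)
import Data.Fin.Properties as Fin
open import Data.List using (List; []; _∷_; length; filter; tabulate)
open import Data.List.Properties using (filter-accept; filter-reject; filter-none; map-tabulate; length-tabulate)
open import Data.List.Membership.Propositional using (_∈_)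
open import Data.List.Membership.Propositional.Properties using (∈-tabulate⁻)
open import Data.List.Relation.Unary.Any using (here; there)
open import Data.List.Relation.Unary.All as All using (All; []; _∷_)
open import Data.List.Relation.Unary.AllPairs using ([]; _∷_)
open import Data.List.Relation.Unary.Unique.Propositional using (Unique)
import Data.List.Relation.Unary.Unique.Propositional.Properties as Unique
open import Data.List.Relation.Binary.Permutation.Propositional using (_↭_; ↭-refl; ↭-prep; ↭-swap; ↭-trans; ↭-sym; ↭⇒↭ₛ)
open import Data.List.Relation.Binary.Permutation.Propositional.Properties using (∈-resp-↭; ↭-length; filter-↭)
open import Data.Maybe using (just; nothing)
open import Data.Nat using (ℕ; zero; suc; _+_; _∸_; _≤_; _<_; _<ᵇ_; z≤n; s≤s; s≤s⁻¹)
open import Data.Nat.Properties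
open import Data.Product using (_×_; _,_; ∃-syntax; proj₁; proj₂)
open import Data.Sum using (_⊎_; inj₁; inj₂)
open import Data.Unit using (⊤; tt)
open import Function using (_∘_; id)
open import Relation.Nullary using (¬_; yes; no)
open import Relation.Binary.PropositionalEquality
open import Data.List.Relation.Binary.Permutation.Setoid.Properties (setoid ℕ) using (Unique-resp-↭)
open import Defs

pick-↭ : ∀ A {j i rest} → pick A j ≡ just (i , rest) → A ↭ i ∷ rest
pick-↭ [] ()
pick-↭ (a ∷ as) {j} e with pick as j in e′
pick-↭ (a ∷ as) refl | just (i , rest) = ↭-trans (↭-prep a (pick-↭ as e′)) (↭-swap a i ↭-refl)
... | nothing with a <ᵇ j
pick-↭ (a ∷ as) refl | nothing | true = ↭-refl
pick-↭ (a ∷ as) () | nothing | false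

pick≡nothing⇒All≮ : ∀ A {j} → pick A j ≡ nothing → All (λ a → ¬ a < j) A
pick≡nothing⇒All≮ [] e = []
pick≡nothing⇒All≮ (a ∷ as) {j} e with pick as j in e′
pick≡nothing⇒All≮ (a ∷ as) () | just _
... | nothing with a <ᵇ j in a≮ᵇj
pick≡nothing⇒All≮ (a ∷ as) () | nothing | true
... | false = (λ a<j → subst T a≮ᵇj (<⇒<ᵇ a<j)) ∷ pick≡nothing⇒All≮ as e′

countBelow : ℕ → List ℕ → ℕ
countBelow j A = length (filter (_<? j) A)

countBelow-resp-↭ : ∀ j {A B} → A ↭ B → countBelow j A ≡ countBelow j B
countBelow-resp-↭ j A↭B = ↭-length (filter-↭ (_<? j) A↭B)

countBelow-∷-≤ : ∀ j a A → countBelow j (a ∷ A) ≤ suc (countBelow j A)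
countBelow-∷-≤ j a A with a <? j
... | yes a<j = ≤-reflexive (cong length (filter-accept (_<? j) a<j))
... | no a≮j = ≤-trans (≤-reflexive (cong length (filter-reject (_<? j) a≮j))) (n≤1+n _)

pick-succeeds : ∀ A j → 1 ≤ countBelow j A → ∃[ i ] ∃[ rest ] (pick A j ≡ just (i , rest))
pick-succeeds A j 1≤count with pick A j in e
... | just (i , rest) = i , rest , refl
... | nothing with () ← subst (1 ≤_) (cong length (filter-none (_<? j) (pick≡nothing⇒All≮ A e))) 1≤count

countBelow-tabulate : ∀ {k} (f : Fin k → ℕ) j (t : Fin k) →
  (∀ c → toℕ c ≤ toℕ t → f c < j) → suc (toℕ t) ≤ countBelow j (tabulate f)
countBelow-tabulate f j fzero below
  rewrite filter-accept (_<? j) {xs = tabulate (f ∘ fsuc)} (below fzero z≤n) = s≤s z≤n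
countBelow-tabulate f j (fsuc t) below
  rewrite filter-accept (_<? j) {xs = tabulate (f ∘ fsuc)} (below fzero z≤n) =
  s≤s (countBelow-tabulate (f ∘ fsuc) j t (λ c c≤t → below (fsuc c) (s≤s c≤t)))

HallFrom : ℕ → List ℕ → List ℕ → Set
HallFrom m U [] = ⊤
HallFrom m U (j ∷ L) = m ≤ countBelow j U × HallFrom (suc m) U L

HallFrom-pick : ∀ {U l i rest} m L → pick U l ≡ just (i , rest) →
  HallFrom (suc m) U L → HallFrom m rest L
HallFrom-pick m [] e _ = tt
HallFrom-pick {U} {i = i} {rest} m (j ∷ L) e (m<count , hall) =
  s≤s⁻¹ (≤-trans m<count countBelow-pick) , HallFrom-pick (suc m) L e hall
  where
  countBelow-pick : countBelow j U ≤ suc (countBelow j rest)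
  countBelow-pick = ≤-trans (≤-reflexive (countBelow-resp-↭ j (pick-↭ U e))) (countBelow-∷-≤ j i rest)

HallFrom-tabulate : ∀ {k} m U (g : Fin k → ℕ) →
  (∀ t → m + toℕ t ≤ countBelow (g t) U) → HallFrom m U (tabulate g)
HallFrom-tabulate {zero} m U g bound = tt
HallFrom-tabulate {suc k} m U g bound =
  subst (_≤ countBelow (g fzero) U) (+-identityʳ m) (bound fzero) ,
  HallFrom-tabulate (suc m) U (g ∘ fsuc)
    (λ t → subst (_≤ countBelow (g (fsuc t)) U) (+-suc m (toℕ t)) (bound (fsuc t)))

pairRows-∈ : ∀ U L {i j} → (i , j) ∈ pairRows U L → i ∈ U × j ∈ L
pairRows-∈ U (l ∷ L) i,j∈P with pick U l in e
pairRows-∈ U (l ∷ L) (here refl) | just (i , rest) = ∈-resp-↭ (↭-sym (pick-↭ U e)) (here refl) , here refl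
pairRows-∈ U (l ∷ L) (there i,j∈P) | just (i , rest) with pairRows-∈ rest L i,j∈P
... | i∈rest , j∈L = ∈-resp-↭ (↭-sym (pick-↭ U e)) (there i∈rest) , there j∈L
pairRows-∈ U (l ∷ L) i,j∈P | nothing with pairRows-∈ U L i,j∈P
... | i∈U , j∈L = i∈U , there j∈L

pairRows-left-unique : ∀ U L → Unique U → ∀ {i j j′} →
  (i , j) ∈ pairRows U L → (i , j′) ∈ pairRows U L → j ≡ j′
pairRows-left-unique U (l ∷ L) uniq a a′ with pick U l in e
... | nothing = pairRows-left-unique U L uniq a a′
... | just (i , rest) with Unique-resp-↭ (↭⇒↭ₛ (pick-↭ U e)) uniq
... | i∉rest ∷ uniq-rest with a | a′
... | here refl | here refl = refl
... | here refl | there a′ = ⊥-elim (All.lookup i∉rest (proj₁ (pairRows-∈ rest L a′)) refl)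
... | there a | here refl = ⊥-elim (All.lookup i∉rest (proj₁ (pairRows-∈ rest L a)) refl)
... | there a | there a′ = pairRows-left-unique rest L uniq-rest a a′

pairRows-right-unique : ∀ U L → Unique L → ∀ {i i′ j} →
  (i , j) ∈ pairRows U L → (i′ , j) ∈ pairRows U L → i ≡ i′
pairRows-right-unique U (l ∷ L) (l∉L ∷ uniq) a a′ with pick U l
... | nothing = pairRows-right-unique U L uniq a a′
... | just (i , rest) with a | a′
... | here refl | here refl = refl
... | here refl | there a′ = ⊥-elim (All.lookup l∉L (proj₂ (pairRows-∈ rest L a′)) refl)
... | there a | here refl = ⊥-elim (All.lookup l∉L (proj₂ (pairRows-∈ rest L a)) refl)
... | there a | there a′ = pairRows-right-unique rest L uniq a a′

pairRows-covers-lower : ∀ U L → HallFrom 1 U L → ∀ {j} → j ∈ L → ∃[ i ] ((i , j) ∈ pairRows U L)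
pairRows-covers-lower U (l ∷ L) (1≤count , hall) j∈L with pick-succeeds U l 1≤count
... | i , rest , e rewrite e with j∈L
... | here refl = i , here refl
... | there j∈L′ with pairRows-covers-lower rest L (HallFrom-pick 1 L e hall) j∈L′
... | i′ , a = i′ , there a

pairRows-covers-upper : ∀ U L → length U ≡ length L → HallFrom 1 U L →
  ∀ {i} → i ∈ U → ∃[ j ] ((i , j) ∈ pairRows U L)
pairRows-covers-upper [] L |U|≡|L| hall ()
pairRows-covers-upper U (l ∷ L) |U|≡|L| (1≤count , hall) i∈U with pick-succeeds U l 1≤count
... | i , rest , e rewrite e
  with ∈-resp-↭ (pick-↭ U e) i∈U | suc-injective (trans (sym (↭-length (pick-↭ U e))) |U|≡|L|)
... | here refl | _ = l , here refl
... | there i∈rest | |rest|≡|L| with pairRows-covers-upper rest L |rest|≡|L| (HallFrom-pick 1 L e hall) i∈rest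
... | j′ , a = j′ , there a

module _ {n k : ℕ} {T : Filling n k} (S : IsRectSYT n k T) where
  open IsRectSYT S

  above-left-below : ∀ {r r′} → r <F r′ → ∀ c t → toℕ c ≤ toℕ t → T r c < T r′ t
  above-left-below {r} {r′} r<r′ c t c≤t with m≤n⇒m<n∨m≡n c≤t
  ... | inj₁ c<t = <-trans (rowIncr r c t c<t) (colIncr t r r′ r<r′)
  ... | inj₂ c≡t rewrite Fin.toℕ-injective c≡t = colIncr t r r′ r<r′

  rows-HallFrom : ∀ {r r′} → r <F r′ → HallFrom 1 (tabulate (T r)) (tabulate (T r′))
  rows-HallFrom {r} {r′} r<r′ = HallFrom-tabulate 1 (tabulate (T r)) (T r′)
    (λ t → countBelow-tabulate (T r) (T r′ t) t (λ c c≤t → above-left-below r<r′ c t c≤t))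

  rowList-tabulate : ∀ y (p : y ∸ 1 < n) → rowList T y ≡ tabulate (T (fromℕ< p))
  rowList-tabulate y p with (y ∸ 1) <? n
  ... | yes _ = map-tabulate id (T (fromℕ< p))
  ... | no y∸1≮n = ⊥-elim (y∸1≮n p)

  ∈-rowList⁻ : ∀ y {v} → v ∈ rowList T y → ∃[ r ] ∃[ c ] (toℕ r ≡ y ∸ 1 × v ≡ T r c)
  ∈-rowList⁻ y v∈row with (y ∸ 1) <? n
  ... | yes p with ∈-tabulate⁻ (subst (_ ∈_) (map-tabulate id (T (fromℕ< p))) v∈row)
  ... | c , v≡T = fromℕ< p , c , Fin.toℕ-fromℕ< p , v≡T

  rowList-unique : ∀ y → Unique (rowList T y)
  rowList-unique y with (y ∸ 1) <? n
  ... | yes _ = Unique.map⁺ (λ e → proj₂ (injective _ _ _ _ e)) (Unique.allFin⁺ k)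
  ... | no _ = []

  rowList-length : ∀ y → y ∸ 1 < n → length (rowList T y) ≡ k
  rowList-length y p rewrite rowList-tabulate y p = length-tabulate _

  -- 1 ≤ y is needed since, by truncated subtraction, rowList T 0 is row 1 again.
  rowList-disjoint : ∀ {y y′ v} → 1 ≤ y → 1 ≤ y′ → v ∈ rowList T y → v ∈ rowList T y′ → y ≡ y′
  rowList-disjoint {suc y} {suc y′} _ _ v∈y v∈y′
    with ∈-rowList⁻ (suc y) v∈y | ∈-rowList⁻ (suc y′) v∈y′
  ... | r , c , r≡y , v≡Trc | r′ , c′ , r′≡y′ , v≡Tr′c′ =
    cong suc (trans (sym r≡y) (trans (cong toℕ r≡r′) r′≡y′))
    where
    r≡r′ : r ≡ r′
    r≡r′ = proj₁ (injective r c r′ c′ (trans (sym v≡Trc) v≡Tr′c′))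

  rowList-HallFrom : ∀ y → 1 ≤ y → suc y ≤ n → HallFrom 1 (rowList T y) (rowList T (suc y))
  rowList-HallFrom (suc y) _ 2+y≤n =
    subst₂ (HallFrom 1) (sym (rowList-tabulate (suc y) y<n)) (sym (rowList-tabulate (suc (suc y)) 2+y≤n))
      (rows-HallFrom r<r′)
    where
    y<n : y < n
    y<n = ≤-trans (n≤1+n _) 2+y≤n
    r<r′ : fromℕ< y<n <F fromℕ< 2+y≤n
    r<r′ = subst₂ _<_ (sym (Fin.toℕ-fromℕ< y<n)) (sym (Fin.toℕ-fromℕ< 2+y≤n)) ≤-refl

  M-endpoints : ∀ y {i j} → (i , j) ∈ M T y → i ∈ rowList T y × j ∈ rowList T (suc y)
  M-endpoints y = pairRows-∈ (rowList T y) (rowList T (suc y))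

  M-left-unique : ∀ y {i j j′} → (i , j) ∈ M T y → (i , j′) ∈ M T y → j ≡ j′
  M-left-unique y = pairRows-left-unique (rowList T y) (rowList T (suc y)) (rowList-unique y)

  M-right-unique : ∀ y {i i′ j} → (i , j) ∈ M T y → (i′ , j) ∈ M T y → i ≡ i′
  M-right-unique y = pairRows-right-unique (rowList T y) (rowList T (suc y)) (rowList-unique (suc y))

  onArc-rowList : ∀ {y i j p z} → ArcOf T y (i , j) → OnArc p (i , j) → 1 ≤ z → p ∈ rowList T z →
    (y ≡ z × i ≡ p) ⊎ (suc y ≡ z × j ≡ p)
  onArc-rowList {y} (1≤y , _ , a∈M) (inj₁ refl) 1≤z p∈z =
    inj₁ (rowList-disjoint 1≤y 1≤z (proj₁ (M-endpoints y a∈M)) p∈z , refl)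
  onArc-rowList {y} (_ , _ , a∈M) (inj₂ refl) 1≤z p∈z =
    inj₂ (rowList-disjoint (s≤s z≤n) 1≤z (proj₂ (M-endpoints y a∈M)) p∈z , refl)

  M-covers-lower : ∀ {y j} → 1 ≤ y → suc y ≤ n → j ∈ rowList T (suc y) → ∃[ i ] ((i , j) ∈ M T y)
  M-covers-lower {y} 1≤y 1+y≤n =
    pairRows-covers-lower (rowList T y) (rowList T (suc y)) (rowList-HallFrom y 1≤y 1+y≤n)

  M-covers-upper : ∀ {y i} → 1 ≤ y → suc y ≤ n → i ∈ rowList T y → ∃[ j ] ((i , j) ∈ M T y)
  M-covers-upper {suc y} 1≤y 2+y≤n =
    pairRows-covers-upper (rowList T (suc y)) (rowList T (suc (suc y)))
      (trans (rowList-length (suc y) (≤-trans (n≤1+n _) 2+y≤n)) (sym (rowList-length (suc (suc y)) 2+y≤n)))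
      (rowList-HallFrom (suc y) 1≤y 2+y≤n)

  left-end-shared : ∀ {x i j} → ArcOf T (suc x) (i , j) → 1 ≤ x →
    ∃[ a ] (ArcOf T x a × OnArc i a ×
      (∀ y b → ArcOf T y b → OnArc i b → ((y , b) ≡ (suc x , (i , j))) ⊎ ((y , b) ≡ (x , a))))
  left-end-shared {x} {i} {j} (_ , 2+x≤n , a∈M) 1≤x
    with M-covers-lower 1≤x (≤-trans (n≤1+n _) 2+x≤n) (proj₁ (M-endpoints (suc x) a∈M))
  ... | i′ , up∈M = (i′ , i) , (1≤x , ≤-trans (n≤1+n _) 2+x≤n , up∈M) , inj₂ refl , only
    where
    only : ∀ y b → ArcOf T y b → OnArc i b → ((y , b) ≡ (suc x , (i , j))) ⊎ ((y , b) ≡ (x , (i′ , i)))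
    only y (b₁ , b₂) arc on with onArc-rowList arc on (s≤s z≤n) (proj₁ (M-endpoints (suc x) a∈M))
    ... | inj₁ (refl , refl) with M-left-unique (suc x) a∈M (proj₂ (proj₂ arc))
    ... | refl = inj₁ refl
    only y (b₁ , b₂) arc on | inj₂ (refl , refl) with M-right-unique x up∈M (proj₂ (proj₂ arc))
    ... | refl = inj₂ refl

  right-end-shared : ∀ {x i j} → ArcOf T x (i , j) → suc x < n →
    ∃[ a ] (ArcOf T (suc x) a × OnArc j a ×
      (∀ y b → ArcOf T y b → OnArc j b → ((y , b) ≡ (x , (i , j))) ⊎ ((y , b) ≡ (suc x , a))))
  right-end-shared {x} {i} {j} (_ , _ , a∈M) 2+x≤n
    with M-covers-upper (s≤s z≤n) 2+x≤n (proj₂ (M-endpoints x a∈M))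
  ... | j′ , down∈M = (j , j′) , (s≤s z≤n , 2+x≤n , down∈M) , inj₁ refl , only
    where
    only : ∀ y b → ArcOf T y b → OnArc j b → ((y , b) ≡ (x , (i , j))) ⊎ ((y , b) ≡ (suc x , (j , j′)))
    only y (b₁ , b₂) arc on with onArc-rowList arc on (s≤s z≤n) (proj₂ (M-endpoints x a∈M))
    ... | inj₁ (refl , refl) with M-left-unique (suc x) down∈M (proj₂ (proj₂ arc))
    ... | refl = inj₂ refl
    only y (b₁ , b₂) arc on | inj₂ (refl , refl) with M-right-unique x a∈M (proj₂ (proj₂ arc))
    ... | refl = inj₁ refl

  left-end-private : ∀ {i j} → ArcOf T 1 (i , j) →
    ∀ y b → ArcOf T y b → OnArc i b → (y , b) ≡ (1 , (i , j))
  left-end-private (_ , _ , a∈M) y (b₁ , b₂) arc on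
    with onArc-rowList arc on (s≤s z≤n) (proj₁ (M-endpoints 1 a∈M))
  ... | inj₁ (refl , refl) with M-left-unique 1 a∈M (proj₂ (proj₂ arc))
  ... | refl = refl
  left-end-private _ y _ (() , _) _ | inj₂ (refl , _)

  right-end-private : ∀ {x i j} → ArcOf T x (i , j) → suc x ≡ n →
    ∀ y b → ArcOf T y b → OnArc j b → (y , b) ≡ (x , (i , j))
  right-end-private {x} (_ , _ , a∈M) 1+x≡n y (b₁ , b₂) arc on
    with onArc-rowList arc on (s≤s z≤n) (proj₂ (M-endpoints x a∈M))
  ... | inj₁ (refl , _) = ⊥-elim (<-irrefl 1+x≡n (proj₁ (proj₂ arc)))
  ... | inj₂ (refl , refl) with M-right-unique x a∈M (proj₂ (proj₂ arc))
  ... | refl = refl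

lemma3p5 : (n k : ℕ) (T : Filling n k) → IsRectSYT n k T →
    ∀ (x i j : ℕ) → ArcOf T x (i , j) →
      ((1 < x → ∃[ a ] (ArcOf T (x ∸ 1) a × OnArc i a ×
          (∀ y b → ArcOf T y b → OnArc i b →
            ((y , b) ≡ (x , (i , j))) ⊎ ((y , b) ≡ (x ∸ 1 , a))))))
      × ((suc x < n → ∃[ a ] (ArcOf T (suc x) a × OnArc j a ×
          (∀ y b → ArcOf T y b → OnArc j b →
            ((y , b) ≡ (x , (i , j))) ⊎ ((y , b) ≡ (suc x , a))))))
      × ((x ≡ 1 → ∀ y b → ArcOf T y b → OnArc i b → (y , b) ≡ (x , (i , j)))
        × (suc x ≡ n → ∀ y b → ArcOf T y b → OnArc j b → (y , b) ≡ (x , (i , j))))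
lemma3p5 n k T S zero i j (() , _)
lemma3p5 n k T S (suc x) i j arc =
  (λ 1<1+x → left-end-shared S arc (s≤s⁻¹ 1<1+x)) ,
  right-end-shared S arc ,
  (λ { refl → left-end-private S arc }) ,
  right-end-private S arc
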